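{- Let $n,k$ be integers with $k\ge1$, $n>2k$. There is a minimum vertex cover of the generalized Petersen graph $P(n,k)$ all of whose strips have size at most $k+1$ when $k$ is odd, and at most $k+2$ when $k$ is even.
   Context: $P(n,k)$ has vertex set $U\cup V$, $U=\{u_1,\dots,u_n\}$, $V=\{v_1,\dots,v_n\}$, edges $u_iu_{i+1}$, $u_iv_i$, $v_iv_{i+k}$ (subscripts modulo $n$). For a vertex cover $c$ not containing all of $V$, a strip of $c$ is a maximal set of circularly consecutive vertices $\{v_i,v_{i+1},\dots,v_{i+m}\}$ of $V$ all belonging to $c$; its size is its number of vertices. -}

module Defs where

open import Data.Nat using (ℕ; zero; suc; _+_; _∸_; _≤_; _<_; _%_; _≡ᵇ_)
open import Data.Nat.DivMod using (m%n<n)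
open import Data.Fin using (Fin; toℕ; fromℕ<)
open import Data.Fin.Subset using (Subset; _∈_; _∉_; ∣_∣)
open import Data.Bool using (if_then_else_)
open import Data.Product using (_×_; Σ; ∃-syntax)
open import Data.Sum using (_⊎_)
open import Relation.Nullary using (¬_)

shift : ∀ {n} → ℕ → Fin n → Fin n
shift {suc n} j i = fromℕ< ((m%n<n (toℕ i + j) (suc n)))

data Vertex (n : ℕ) : Set where
  u : Fin n → Vertex n
  v : Fin n → Vertex n

data PEdge (n k : ℕ) : Vertex n → Vertex n → Set where
  outer : (i : Fin n) → PEdge n k (u i) (u (shift 1 i))
  spoke : (i : Fin n) → PEdge n k (u i) (v i)
  inner : (i : Fin n) → PEdge n k (v i) (v (shift k i))

record VSet (n : ℕ) : Set where
  constructor ⟨_,_⟩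
  field
    onU : Subset n
    onV : Subset n
open VSet public

_∈V_ : ∀ {n} → Vertex n → VSet n → Set
u i ∈V c = i ∈ onU c
v i ∈V c = i ∈ onV c

size : ∀ {n} → VSet n → ℕ
size c = ∣ onU c ∣ + ∣ onV c ∣

IsVertexCover : (n k : ℕ) → VSet n → Set
IsVertexCover n k c = ∀ x y → PEdge n k x y → (x ∈V c) ⊎ (y ∈V c)

IsMinVertexCover : (n k : ℕ) → VSet n → Set
IsMinVertexCover n k c =
  IsVertexCover n k c × (∀ d → IsVertexCover n k d → size c ≤ size d)

NotAllV : ∀ {n} → VSet n → Set
NotAllV {n} c = ∃[ i ] (i ∉ onV c)

-- the strip {v_i, v_{i+1}, ..., v_{i+m}} (size m+1) of c:
-- a maximal set of circularly consecutive V-vertices all in c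
IsStrip : ∀ {n} → VSet n → Fin n → ℕ → Set
IsStrip {n} c i m =
  m < n
  × (∀ j → j ≤ m → shift j i ∈ onV c)
  × (shift (n ∸ 1) i ∉ onV c)      -- v_{i-1} ∉ c
  × (shift (suc m) i ∉ onV c)

stripBound : ℕ → ℕ
stripBound k = if (k % 2 ≡ᵇ 1) then suc k else suc (suc k)

module Submission where

-- Among all vertex covers we choose one minimising, lexicographically,
--   (size, number of V-vertices, number of runs of k+2 consecutive V-vertices),
-- where a run is counted by its first vertex.  Such an optimal cover exists
-- because the lexicographic order on ℕ³ is well founded and, the vertex sets
-- being finite, "there is a smaller cover" is decidable.  Two exchange
-- arguments then constrain an optimal cover c:
--   * (trade) if v_y, v_{y+k}, v_{y+2k} ∈ c, replacing v_{y+k} by u_{y+k} gives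
--     a cover with no more vertices and fewer V-vertices; so c has no such
--     triple, and in particular c does not contain all of V;
--   * (shorten) a strip of size ≥ k+2 starting at v_i forces v_{i-k} ∉ c
--     (no triples), and then moving v_{i+1} to v_{i-k+1} and u_i to u_{i+1}
--     gives a cover with no more vertices, no more V-vertices and strictly
--     fewer runs.
-- Hence every strip of c has size at most k+1, which is at most stripBound k.

open import Defs
open import Data.Nat using (ℕ; zero; suc; _+_; _*_; _∸_; _≤_; _<_; _%_; _/_; _≡ᵇ_; z≤n; s≤s; _<?_)
open import Data.Nat.Properties
  using (≤-refl; ≤-trans; <⇒≤; ≤-<-trans; <-≤-trans; <⇒≢; ≤⇒≯; ≮⇒≥; ≤-pred; n≤1+n; m≤m+n;
         +-comm; +-assoc; +-suc; +-identityʳ; +-cancelˡ-≡; +-mono-≤; +-monoˡ-≤; +-monoʳ-≤;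
         m∸n+n≡m; m+[n∸m]≡n; m≤n⇒m<n∨m≡n; allUpTo?; module ≤-Reasoning)
  renaming (_≟_ to _≟ℕ_)
open import Data.Nat.DivMod using (m≡m%n+[m/n]*n; m<n⇒m%n≡m; [m+n]%n≡m%n; %-distribˡ-+; m%n%n≡m%n)
open import Data.Nat.Induction using (<-wellFounded)
open import Data.Bool using (true; false)
open import Data.Fin using (Fin; zero; suc; toℕ) renaming (_≟_ to _≟F_)
open import Data.Fin.Properties using (toℕ-fromℕ<; toℕ-injective; toℕ<n; all?; any?)
open import Data.Fin.Subset using (Subset; _∈_; _∉_; ∣_∣; _⊆_; _⊂_; inside; outside; ⊤)
open import Data.Fin.Subset.Properties using (_∈?_; anySubset?; p⊆q⇒∣p∣≤∣q∣; p⊂q⇒∣p∣<∣q∣; ∈⊤)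
open import Data.Vec using (_∷_; _[_]≔_; tabulate; lookup)
open import Data.Vec.Properties
  using ([]≔-updates; []≔-minimal; []≔-lookup; []≔-idempotent; lookup∘tabulate; []=⇒lookup; lookup⇒[]=)
open import Data.Product using (_×_; _,_; ∃-syntax; proj₁; proj₂)
open import Data.Product.Relation.Binary.Lex.Strict using (×-Lex; ×-wellFounded; ×-decidable)
open import Data.Empty using (⊥; ⊥-elim)
open import Data.Sum using (_⊎_; inj₁; inj₂)
import Data.Sum as Sum
open import Function using (_∘_; _on_)
open import Induction.WellFounded using (WellFounded; Acc; acc)
open import Level using (0ℓ)
open import Relation.Binary using (Rel)
open import Relation.Binary.Construct.On as On using ()
open import Relation.Binary.PropositionalEquality
open import Relation.Nullary using (¬_; Dec; yes; no; does; contradiction)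
open import Relation.Nullary.Decidable using (dec-true; map′; _×-dec_; _⊎-dec_; ¬?; decidable-stable)
open import Relation.Unary using (Pred)

module _ {N : ℕ} where
  private
    n : ℕ
    n = suc N

  toℕ-shift : ∀ j (i : Fin n) → toℕ (shift j i) ≡ (toℕ i + j) % n
  toℕ-shift j i = toℕ-fromℕ< _

  %-absorbˡ : ∀ x a → (x % n + a) % n ≡ (x + a) % n
  %-absorbˡ x a = begin
    (x % n + a) % n          ≡⟨ %-distribˡ-+ (x % n) a n ⟩
    (x % n % n + a % n) % n  ≡⟨ cong (λ y → (y + a % n) % n) (m%n%n≡m%n x n) ⟩
    (x % n + a % n) % n      ≡⟨ %-distribˡ-+ x a n ⟨
    (x + a) % n              ∎
    where open ≡-Reasoning

  shift-zero : (i : Fin n) → shift 0 i ≡ i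
  shift-zero i = toℕ-injective (begin
    toℕ (shift 0 i)    ≡⟨ toℕ-shift 0 i ⟩
    (toℕ i + 0) % n    ≡⟨ cong (_% n) (+-identityʳ (toℕ i)) ⟩
    toℕ i % n          ≡⟨ m<n⇒m%n≡m (toℕ<n i) ⟩
    toℕ i              ∎)
    where open ≡-Reasoning

  shift-full : (i : Fin n) → shift n i ≡ i
  shift-full i = toℕ-injective (begin
    toℕ (shift n i)    ≡⟨ toℕ-shift n i ⟩
    (toℕ i + n) % n    ≡⟨ [m+n]%n≡m%n (toℕ i) n ⟩
    toℕ i % n          ≡⟨ m<n⇒m%n≡m (toℕ<n i) ⟩
    toℕ i              ∎)
    where open ≡-Reasoning

  shift-shift : ∀ a b (i : Fin n) → shift a (shift b i) ≡ shift (b + a) i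
  shift-shift a b i = toℕ-injective (begin
    toℕ (shift a (shift b i))  ≡⟨ toℕ-shift a (shift b i) ⟩
    (toℕ (shift b i) + a) % n  ≡⟨ cong (λ y → (y + a) % n) (toℕ-shift b i) ⟩
    ((toℕ i + b) % n + a) % n  ≡⟨ %-absorbˡ (toℕ i + b) a ⟩
    (toℕ i + b + a) % n        ≡⟨ cong (_% n) (+-assoc (toℕ i) b a) ⟩
    (toℕ i + (b + a)) % n      ≡⟨ toℕ-shift (b + a) i ⟨
    toℕ (shift (b + a) i)      ∎)
    where open ≡-Reasoning

  shift-comm : ∀ a b (i : Fin n) → shift a (shift b i) ≡ shift b (shift a i)
  shift-comm a b i = begin
    shift a (shift b i)  ≡⟨ shift-shift a b i ⟩
    shift (b + a) i      ≡⟨ cong (λ s → shift s i) (+-comm b a) ⟩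
    shift (a + b) i      ≡⟨ shift-shift b a i ⟨
    shift b (shift a i)  ∎
    where open ≡-Reasoning

  shift-back : ∀ {a} → a ≤ n → (i : Fin n) → shift a (shift (n ∸ a) i) ≡ i
  shift-back {a} a≤n i = begin
    shift a (shift (n ∸ a) i)  ≡⟨ shift-shift a (n ∸ a) i ⟩
    shift (n ∸ a + a) i        ≡⟨ cong (λ s → shift s i) (m∸n+n≡m a≤n) ⟩
    shift n i                  ≡⟨ shift-full i ⟩
    i                          ∎
    where open ≡-Reasoning

  shift-cancel : ∀ {a} → a ≤ n → (i : Fin n) → shift (n ∸ a) (shift a i) ≡ i
  shift-cancel {a} a≤n i = begin
    shift (n ∸ a) (shift a i)  ≡⟨ shift-shift (n ∸ a) a i ⟩
    shift (a + (n ∸ a)) i      ≡⟨ cong (λ s → shift s i) (m+[n∸m]≡n a≤n) ⟩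
    shift n i                  ≡⟨ shift-full i ⟩
    i                          ∎
    where open ≡-Reasoning

  shift-injective : ∀ {a} → a ≤ n → {x y : Fin n} → shift a x ≡ shift a y → x ≡ y
  shift-injective {a} a≤n {x} {y} eq = begin
    x                          ≡⟨ shift-cancel a≤n x ⟨
    shift (n ∸ a) (shift a x)  ≡⟨ cong (shift (n ∸ a)) eq ⟩
    shift (n ∸ a) (shift a y)  ≡⟨ shift-cancel a≤n y ⟩
    y                          ∎
    where open ≡-Reasoning

  -- A shift by 0 < d < n has no fixed point: a fixed point would make d a
  -- multiple of n.
  shift-moves : ∀ {d} → 0 < d → d < n → (y : Fin n) → shift d y ≢ y
  shift-moves {d} 0<d d<n y eq = not-multiple ((toℕ y + d) / n) d≡qn
    where
    d≡qn : d ≡ (toℕ y + d) / n * n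
    d≡qn = +-cancelˡ-≡ (toℕ y) _ _ (begin
      toℕ y + d                                 ≡⟨ m≡m%n+[m/n]*n (toℕ y + d) n ⟩
      (toℕ y + d) % n + (toℕ y + d) / n * n     ≡⟨ cong (_+ (toℕ y + d) / n * n) (trans (sym (toℕ-shift d y)) (cong toℕ eq)) ⟩
      toℕ y + (toℕ y + d) / n * n               ∎)
      where open ≡-Reasoning
    not-multiple : ∀ q → d ≢ q * n
    not-multiple zero    d≡0  = <⇒≢ 0<d (sym d≡0)
    not-multiple (suc q) d≡qn = ≤⇒≯ (subst (n ≤_) (sym d≡qn) (m≤m+n n (q * n))) d<n

private
  variable
    m : ℕ

add remove : Fin m → Subset m → Subset m
add x p = p [ x ]≔ inside
remove x p = p [ x ]≔ outside

∈-add-self : ∀ x (p : Subset m) → x ∈ add x p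
∈-add-self x p = []≔-updates p x

∉-remove-self : ∀ x (p : Subset m) → x ∉ remove x p
∉-remove-self x p x∈ with () ← trans (sym ([]=⇒lookup x∈)) ([]=⇒lookup ([]≔-updates p x))

∈-update⁺ : ∀ {x y b} {p : Subset m} → y ≢ x → y ∈ p → y ∈ p [ x ]≔ b
∈-update⁺ {x = x} {y} {p = p} y≢x = []≔-minimal p y x y≢x

∈-update⁻ : ∀ {x y b} {p : Subset m} → y ≢ x → y ∈ p [ x ]≔ b → y ∈ p
∈-update⁻ {x = x} {y} {b} {p} y≢x y∈ = subst (y ∈_) restore ([]≔-minimal (p [ x ]≔ b) y x y≢x y∈)
  where
  restore : (p [ x ]≔ b) [ x ]≔ lookup p x ≡ p
  restore = trans ([]≔-idempotent p x) ([]≔-lookup p x)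

∈-add : ∀ x {y} {p : Subset m} → y ∈ p → y ∈ add x p
∈-add x {y} {p} y∈ with y ≟F x
... | yes refl = ∈-add-self y p
... | no y≢x   = ∈-update⁺ y≢x y∈

∈-add⁻ : ∀ x {y} {p : Subset m} → y ∈ add x p → y ≡ x ⊎ y ∈ p
∈-add⁻ x {y} y∈ with y ≟F x
... | yes y≡x = inj₁ y≡x
... | no y≢x  = inj₂ (∈-update⁻ y≢x y∈)

∈-remove⁻ : ∀ x {y} {p : Subset m} → y ∈ remove x p → y ∈ p
∈-remove⁻ x {y} {p} y∈ with y ≟F x
... | yes refl = contradiction y∈ (∉-remove-self y p)
... | no y≢x   = ∈-update⁻ y≢x y∈

add-member : ∀ {x} {p : Subset m} → x ∈ p → add x p ≡ p
add-member {x = x} {p} x∈ = trans (cong (p [ x ]≔_) (sym ([]=⇒lookup x∈))) ([]≔-lookup p x)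

∣add∣≤ : ∀ x (p : Subset m) → ∣ add x p ∣ ≤ suc ∣ p ∣
∣add∣≤ zero    (outside ∷ p) = ≤-refl
∣add∣≤ zero    (inside  ∷ p) = n≤1+n _
∣add∣≤ (suc x) (outside ∷ p) = ∣add∣≤ x p
∣add∣≤ (suc x) (inside  ∷ p) = s≤s (∣add∣≤ x p)

∣remove∣≤ : ∀ x (p : Subset m) → ∣ remove x p ∣ ≤ ∣ p ∣
∣remove∣≤ x p = p⊆q⇒∣p∣≤∣q∣ {p = remove x p} {q = p} (∈-remove⁻ x)

∣remove-member∣ : ∀ {x} {p : Subset m} → x ∈ p → ∣ remove x p ∣ < ∣ p ∣
∣remove-member∣ {x = x} {p} x∈ = p⊂q⇒∣p∣<∣q∣ (∈-remove⁻ x , x , x∈ , ∉-remove-self x p)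

∣move∣≤ : ∀ {x y} {p : Subset m} → y ≢ x → x ∈ p ⊎ y ∈ p → ∣ add y (remove x p) ∣ ≤ ∣ p ∣
∣move∣≤ {x = x} {y} {p} y≢x (inj₁ x∈) = ≤-trans (∣add∣≤ y (remove x p)) (∣remove-member∣ x∈)
∣move∣≤ {x = x} {y} {p} y≢x (inj₂ y∈) =
  subst (_≤ ∣ p ∣) (cong ∣_∣ (sym (add-member (∈-update⁺ y≢x y∈)))) (∣remove∣≤ x p)

Run : ℕ → Subset m → Fin m → Set
Run L p x = ∀ {t} → t < L → shift t x ∈ p

run? : ∀ L (p : Subset m) x → Dec (Run L p x)
run? L p x = allUpTo? (λ t → shift t x ∈? p) L

runs : ℕ → Subset m → Subset m
runs L p = tabulate (λ x → does (run? L p x))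

∈-runs⁺ : ∀ {L} {p : Subset m} {x} → Run L p x → x ∈ runs L p
∈-runs⁺ {L = L} {p} {x} run =
  lookup⇒[]= x (runs L p) (trans (lookup∘tabulate _ x) (dec-true (run? L p x) run))

∈-runs⁻ : ∀ {L} {p : Subset m} {x} → x ∈ runs L p → Run L p x
∈-runs⁻ {L = L} {p} {x} x∈ =
  witness (run? L p x) (trans (sym (lookup∘tabulate _ x)) ([]=⇒lookup x∈))
  where
  witness : ∀ {A : Set} (a? : Dec A) → does a? ≡ true → A
  witness (yes a) _ = a

run-start : ∀ {L} {p : Subset (suc m)} {x} → Run L p x → 0 < L → x ∈ p
run-start {p = p} {x} run 0<L = subst (_∈ p) (shift-zero x) (run 0<L)

-- Adding one element q can only create runs through q.  If neither the
-- predecessor r of q nor the k-th successor of q lies in p′, no run of length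
-- L > k in p′ passes through q, so every run of p′ is already a run of p.
runs-transfer : ∀ {N k L} {p p′ : Subset (suc N)} {q r : Fin (suc N)} →
  k < L → (∀ {x} → x ∈ p′ → x ≡ q ⊎ x ∈ p) →
  shift 1 r ≡ q → r ∉ p′ → shift k q ∉ p′ → runs L p′ ⊆ runs L p
runs-transfer {k = k} {L} {p} {p′} {q} {r} k<L p′⊆p∪q r+1≡q r∉ q+k∉ {x} x∈ = ∈-runs⁺ run-in-p
  where
  run : Run L p′ x
  run = ∈-runs⁻ x∈
  avoids : ∀ {t} → t < L → shift t x ≢ q
  avoids {zero} _ x≡q = q+k∉ (subst (λ y → shift k y ∈ p′) (trans (sym (shift-zero x)) x≡q) (run k<L))
  avoids {suc t} t+1<L eq = r∉ (subst (_∈ p′) t≡r (run (<⇒≤ t+1<L)))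
    where
    t≡r : shift t x ≡ r
    t≡r = shift-injective (s≤s z≤n) (begin
      shift 1 (shift t x)  ≡⟨ shift-shift 1 t x ⟩
      shift (t + 1) x      ≡⟨ cong (λ s → shift s x) (+-comm t 1) ⟩
      shift (suc t) x      ≡⟨ eq ⟩
      q                    ≡⟨ r+1≡q ⟨
      shift 1 r            ∎)
      where open ≡-Reasoning
  run-in-p : Run L p x
  run-in-p {t} t<L with p′⊆p∪q (run t<L)
  ... | inj₁ t≡q = contradiction t≡q (avoids t<L)
  ... | inj₂ t∈p = t∈p

module _ {a ℓ p} {A : Set a} {_≺_ : Rel A ℓ} {P : Pred A p}
         (wf : WellFounded _≺_) (below? : ∀ x → Dec (∃[ y ] P y × y ≺ x)) where

  minimal : ∀ {x} → P x → ∃[ y ] P y × (∀ z → P z → ¬ z ≺ y)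
  minimal {x} px = descend (wf x) px
    where
    descend : ∀ {x} → Acc _≺_ x → P x → ∃[ y ] P y × (∀ z → P z → ¬ z ≺ y)
    descend {x} (acc rs) px with below? x
    ... | yes (y , py , y≺x) = descend (rs y≺x) py
    ... | no nothing-below   = x , px , λ z pz z≺x → nothing-below (z , pz , z≺x)

_<ₗ_ : Rel (ℕ × ℕ × ℕ) 0ℓ
_<ₗ_ = ×-Lex _≡_ _<_ (×-Lex _≡_ _<_ _<_)

<ₗ-wellFounded : WellFounded _<ₗ_
<ₗ-wellFounded = ×-wellFounded <-wellFounded (×-wellFounded <-wellFounded <-wellFounded)

_<ₗ?_ : ∀ a b → Dec (a <ₗ b)
_<ₗ?_ = ×-decidable _≟ℕ_ _<?_ (×-decidable _≟ℕ_ _<?_ _<?_)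

<ₗ-second : ∀ {a a′ b b′ c c′} → a ≤ a′ → b < b′ → (a , b , c) <ₗ (a′ , b′ , c′)
<ₗ-second a≤a′ b<b′ with m≤n⇒m<n∨m≡n a≤a′
... | inj₁ a<a′ = inj₁ a<a′
... | inj₂ refl = inj₂ (refl , inj₁ b<b′)

<ₗ-third : ∀ {a a′ b b′ c c′} → a ≤ a′ → b ≤ b′ → c < c′ → (a , b , c) <ₗ (a′ , b′ , c′)
<ₗ-third a≤a′ b≤b′ c<c′ with m≤n⇒m<n∨m≡n b≤b′
... | inj₁ b<b′ = <ₗ-second a≤a′ b<b′
... | inj₂ refl with m≤n⇒m<n∨m≡n a≤a′
...   | inj₁ a<a′ = inj₁ a<a′
...   | inj₂ refl = inj₂ (refl , inj₂ (refl , c<c′))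

module Petersen (N k : ℕ) (k≥1 : 1 ≤ k) (k<n : k < suc N) where

  n : ℕ
  n = suc N

  Cover : VSet n → Set
  Cover = IsVertexCover n k

  CoveredAt : VSet n → Fin n → Set
  CoveredAt c i = (i ∈ onU c ⊎ shift 1 i ∈ onU c)
                × (i ∈ onU c ⊎ i ∈ onV c)
                × (i ∈ onV c ⊎ shift k i ∈ onV c)

  cover? : (c : VSet n) → Dec (Cover c)
  cover? c = map′ fromLocal toLocal (all? covered?)
    where
    covered? : ∀ i → Dec (CoveredAt c i)
    covered? i = ((i ∈? onU c) ⊎-dec (shift 1 i ∈? onU c))
            ×-dec ((i ∈? onU c) ⊎-dec (i ∈? onV c))
            ×-dec ((i ∈? onV c) ⊎-dec (shift k i ∈? onV c))
    fromLocal : (∀ i → CoveredAt c i) → Cover c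
    fromLocal covered _ _ (outer i) = proj₁ (covered i)
    fromLocal covered _ _ (spoke i) = proj₁ (proj₂ (covered i))
    fromLocal covered _ _ (inner i) = proj₂ (proj₂ (covered i))
    toLocal : Cover c → ∀ i → CoveredAt c i
    toLocal cov i = cov _ _ (outer i) , cov _ _ (spoke i) , cov _ _ (inner i)

  full-cover : Cover ⟨ ⊤ , ⊤ ⟩
  full-cover _ _ (outer i) = inj₁ ∈⊤
  full-cover _ _ (spoke i) = inj₁ ∈⊤
  full-cover _ _ (inner i) = inj₁ ∈⊤

  weight : VSet n → ℕ × ℕ × ℕ
  weight c = size c , ∣ onV c ∣ , ∣ runs (2 + k) (onV c) ∣

  _≺_ : Rel (VSet n) 0ℓ
  _≺_ = _<ₗ_ on weight

  smaller-cover? : ∀ c → Dec (∃[ d ] Cover d × d ≺ c)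
  smaller-cover? c =
    map′ (λ (U , V , h) → ⟨ U , V ⟩ , h) (λ (d , h) → onU d , onV d , h)
      (anySubset? λ U → anySubset? λ V → cover? ⟨ U , V ⟩ ×-dec (weight ⟨ U , V ⟩ <ₗ? weight c))

  -- A vertex cover admitting no smaller cover in the order ≺.  Only its
  -- specification matters, so the exhaustive search is kept opaque.
  opaque
    optimal : ∃[ c ] Cover c × (∀ d → Cover d → ¬ d ≺ c)
    optimal = minimal (On.wellFounded weight <ₗ-wellFounded) smaller-cover? full-cover

  k-moves : (x : Fin n) → shift k x ≢ x
  k-moves = shift-moves k≥1 k<n

  k-back : (x : Fin n) → shift k (shift (n ∸ k) x) ≡ x
  k-back = shift-back (<⇒≤ k<n)

  module Trade {c : VSet n} (cov : Cover c) (y : Fin n)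
               (y∈ : y ∈ onV c) (y+k∈ : shift k y ∈ onV c) (y+2k∈ : shift k (shift k y) ∈ onV c) where

    private
      U V : Subset n
      U = onU c
      V = onV c
      w : Fin n
      w = shift k y

    traded : VSet n
    traded = ⟨ add w U , remove w V ⟩

    cover : Cover traded
    cover _ _ (outer i) = Sum.map (∈-add w) (∈-add w) (cov _ _ (outer i))
    cover _ _ (spoke i) with i ≟F w
    ... | yes refl = inj₁ (∈-add-self w U)
    ... | no i≢w   = Sum.map (∈-add w) (∈-update⁺ i≢w) (cov _ _ (spoke i))
    cover _ _ (inner i) with i ≟F w | shift k i ≟F w
    ... | yes refl | _        = inj₂ (∈-update⁺ (k-moves w) y+2k∈)
    ... | no i≢w   | yes i+k≡w =
      inj₁ (∈-update⁺ i≢w (subst (_∈ V) (sym (shift-injective (<⇒≤ k<n) i+k≡w)) y∈))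
    ... | no i≢w   | no i+k≢w  = Sum.map (∈-update⁺ i≢w) (∈-update⁺ i+k≢w) (cov _ _ (inner i))

    fewer-V : ∣ onV traded ∣ < ∣ V ∣
    fewer-V = ∣remove-member∣ y+k∈

    no-larger : size traded ≤ size c
    no-larger = begin
      ∣ add w U ∣ + ∣ remove w V ∣      ≤⟨ +-monoˡ-≤ _ (∣add∣≤ w U) ⟩
      suc ∣ U ∣ + ∣ remove w V ∣        ≡⟨ +-suc ∣ U ∣ _ ⟨
      ∣ U ∣ + suc ∣ remove w V ∣        ≤⟨ +-monoʳ-≤ ∣ U ∣ fewer-V ⟩
      ∣ U ∣ + ∣ V ∣                     ∎
      where open ≤-Reasoning

  -- Moving
  -- v_{i+1} to v_{i-k+1} and u_i to u_{i+1} keeps a cover with no more vertices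
  -- and no more V-vertices; it destroys the run of k+2 V-vertices starting at
  -- v_i and creates none, since the new vertex v_{i-k+1} is isolated from
  -- runs by v_{i-k} and v_{i+1}, which are both absent from the new cover.
  module Shorten {c : VSet n} (cov : Cover c) (i : Fin n)
                 (i-1∉ : shift N i ∉ onV c) (run : Run (2 + k) (onV c) i)
                 (i-k∉ : shift (n ∸ k) i ∉ onV c) where

    private
      U V U′ V′ : Subset n
      U = onU c
      V = onV c
      e r q : Fin n
      e = shift 1 i
      r = shift (n ∸ k) i
      q = shift 1 r
      U′ = add e (remove i U)
      V′ = remove e (add q V)

      q+k≡e : shift k q ≡ e
      q+k≡e = trans (shift-comm k 1 r) (cong (shift 1) (k-back i))

      e≢i : e ≢ i
      e≢i = shift-moves (s≤s z≤n) (≤-<-trans k≥1 k<n) i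

      q≢e : q ≢ e
      q≢e q≡e = k-moves q (trans q+k≡e (sym q≡e))

      e∈V : e ∈ V
      e∈V = run (s≤s (s≤s z≤n))

      e+k∈V : shift k e ∈ V
      e+k∈V = subst (_∈ V) (sym (shift-shift k 1 i)) (run ≤-refl)

      -- v_{i-1} ∉ c, so its spoke forces u_{i-1} ∈ c.
      i-1∈U : shift N i ∈ U
      i-1∈U with cov _ _ (spoke (shift N i))
      ... | inj₁ i-1∈ = i-1∈
      ... | inj₂ i-1∈ = contradiction i-1∈ i-1∉

      keepU : ∀ {x} → x ≢ i → x ∈ U → x ∈ U′
      keepU x≢i = ∈-add e ∘ ∈-update⁺ x≢i

      keepV : ∀ {x} → x ≢ e → x ∈ V → x ∈ V′
      keepV x≢e = ∈-update⁺ x≢e ∘ ∈-add q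

      q∈V′ : q ∈ V′
      q∈V′ = ∈-update⁺ q≢e (∈-add-self q V)

    shortened : VSet n
    shortened = ⟨ U′ , V′ ⟩

    cover : Cover shortened
    cover _ _ (outer x) with x ≟F i | shift 1 x ≟F i
    ... | yes refl | _         = inj₂ (∈-add-self e _)
    ... | no x≢i   | yes x+1≡i = inj₁ (keepU x≢i (subst (_∈ U) (sym x≡i-1) i-1∈U))
      where
      x≡i-1 : x ≡ shift N i
      x≡i-1 = shift-injective (s≤s z≤n) (trans x+1≡i (sym (shift-back (s≤s z≤n) i)))
    ... | no x≢i   | no x+1≢i  = Sum.map (keepU x≢i) (keepU x+1≢i) (cov _ _ (outer x))
    cover _ _ (spoke x) with x ≟F e | x ≟F i
    ... | yes refl | _        = inj₁ (∈-add-self e _)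
    ... | no x≢e   | yes refl = inj₂ (keepV x≢e (run-start run (s≤s z≤n)))
    ... | no x≢e   | no x≢i   = Sum.map (keepU x≢i) (keepV x≢e) (cov _ _ (spoke x))
    cover _ _ (inner x) with x ≟F e | shift k x ≟F e
    ... | yes refl | _         = inj₂ (keepV (k-moves e) e+k∈V)
    ... | no x≢e   | yes x+k≡e =
      inj₁ (subst (_∈ V′) (sym (shift-injective (<⇒≤ k<n) (trans x+k≡e (sym q+k≡e)))) q∈V′)
    ... | no x≢e   | no x+k≢e  = Sum.map (keepV x≢e) (keepV x+k≢e) (cov _ _ (inner x))

    no-more-V : ∣ V′ ∣ ≤ ∣ V ∣
    no-more-V = ≤-pred (<-≤-trans (∣remove-member∣ (∈-add q e∈V)) (∣add∣≤ q V))

    no-larger : size shortened ≤ size c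
    no-larger = +-mono-≤ (∣move∣≤ e≢i (cov _ _ (outer i))) no-more-V

    -- v_i starts a run of V but not of V′ (as v_{i+1} ∉ V′), and every run of V′
    -- is one of V.
    fewer-runs : runs (2 + k) V′ ⊂ runs (2 + k) V
    fewer-runs = runs-transfer (s≤s (n≤1+n k)) V′⊆V∪q refl r∉V′ q+k∉V′
               , i , ∈-runs⁺ run , λ i∈ → ∉-remove-self e _ (∈-runs⁻ i∈ (s≤s (s≤s z≤n)))
      where
      V′⊆V∪q : ∀ {x} → x ∈ V′ → x ≡ q ⊎ x ∈ V
      V′⊆V∪q = ∈-add⁻ q ∘ ∈-remove⁻ e
      r∉V′ : r ∉ V′
      r∉V′ r∈ with V′⊆V∪q r∈
      ... | inj₁ r≡q = shift-moves (s≤s z≤n) (≤-<-trans k≥1 k<n) r (sym r≡q)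
      ... | inj₂ r∈V = i-k∉ r∈V
      q+k∉V′ : shift k q ∉ V′
      q+k∉V′ = subst (_∉ V′) (sym q+k≡e) (∉-remove-self e _)

  module Optimal {c : VSet n} (cov : Cover c) (opt : ∀ d → Cover d → ¬ d ≺ c) where

    private
      V : Subset n
      V = onV c

    -- Nothing ≺-below c has smaller size, so c is a minimum cover.
    minimum : ∀ d → Cover d → size c ≤ size d
    minimum d d-cov = ≮⇒≥ λ d<c → opt d d-cov (inj₁ d<c)

    no-triple : ∀ y → y ∈ V → shift k y ∈ V → shift k (shift k y) ∈ V → ⊥
    no-triple y y∈ y+k∈ y+2k∈ = opt traded cover (<ₗ-second no-larger fewer-V)
      where open Trade cov y y∈ y+k∈ y+2k∈

    -- If all of V were in c, v_0, v_k, v_{2k} would form a forbidden triple.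
    not-all-V : NotAllV c
    not-all-V with any? (λ x → ¬? (x ∈? V))
    ... | yes missing = missing
    ... | no none     = ⊥-elim (no-triple zero (in-V _) (in-V _) (in-V _))
      where
      in-V : ∀ x → x ∈ V
      in-V x = decidable-stable (x ∈? V) (λ x∉ → none (x , x∉))

    no-long-run : ∀ i → shift N i ∉ V → ¬ Run (2 + k) V i
    no-long-run i i-1∉ run = opt shortened cover (<ₗ-third no-larger no-more-V (p⊂q⇒∣p∣<∣q∣ fewer-runs))
      where
      i-k∉ : shift (n ∸ k) i ∉ V
      i-k∉ i-k∈ = no-triple _ i-k∈ (subst (_∈ V) (sym (k-back i)) (run-start run (s≤s z≤n)))
                    (subst (λ x → shift k x ∈ V) (sym (k-back i)) (run (s≤s (n≤1+n k))))
      open Shorten cov i i-1∉ run i-k∉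

    -- A strip of size ≥ k+2 would contain such a run.
    strip-short : ∀ i m → IsStrip c i m → suc m ≤ suc k
    strip-short i m (_ , in-strip , i-1∉ , _) =
      ≮⇒≥ λ long → no-long-run i i-1∉ λ t<2+k → in-strip _ (≤-pred (≤-trans t<2+k long))

  short-strip-cover : ∃[ c ] (IsMinVertexCover n k c × NotAllV c
                        × (∀ i m → IsStrip c i m → suc m ≤ suc k))
  short-strip-cover with optimal
  ... | c , cov , opt = c , (cov , minimum) , not-all-V , strip-short
    where open Optimal cov opt

k+1≤stripBound : ∀ k → suc k ≤ stripBound k
k+1≤stripBound k with k % 2 ≡ᵇ 1
... | true  = ≤-refl
... | false = n≤1+n _

theorem6 : (n k : ℕ) → 1 ≤ k → 2 * k < n →
    ∃[ c ] (IsMinVertexCover n k c × NotAllV c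
      × (∀ (i : Fin n) (m : ℕ) → IsStrip c i m → suc m ≤ stripBound k))
theorem6 zero    k k≥1 ()
theorem6 (suc N) k k≥1 2k<n with Petersen.short-strip-cover N k k≥1 (≤-<-trans (m≤m+n k (k + zero)) 2k<n)
... | c , minimum , not-all-V , strip-short =
  c , minimum , not-all-V , λ i m strip → ≤-trans (strip-short i m strip) (k+1≤stripBound k)
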